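{- In the group $G=\mathbb{Z}_2\times\mathbb{Z}_3\times\mathbb{Z}_3$, let $$P=\{(0,x,1),(0,x,2),(1,2,x): x\in\{0,1,2\}\}\cup\{(1,0,1),(1,1,0)\}$$ and $N=\{(1,0,0),(1,1,1)\}$. Then $D=P-N$ is a signed difference set in $G$ (with parameters $(18,13,4)$).
   Context: Let $G$ be a finite group of order $v$ and $\mathbb{Z}[G]$ its integral group ring; a subset $S\subseteq G$ is identified with $\sum_{g\in S} g\in\mathbb{Z}[G]$. A $(v,k,\lambda)$ signed difference set in $G$ is an element $D=\sum_{g\in G}s_g g$ with all $s_g\in\{ -1,0,1\}$ such that, with $P=\{g:s_g=1\}$, $N=\{g:s_g=-1\}$ and $k=\lvert P\rvert+\lvert N\rvert$, one has $DD^{(-1)}=(k-\lambda)\cdot 1_G+\lambda\sum_{g\in G}g$, where $D^{(-1)}=\sum_g s_g g^{ -1}$. Equivalently, for an abelian group written additively, $\sum_{g\in G} s_g s_{g+h}=\lambda$ for every nonzero $h\in G$. -}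

module Defs where

open import Data.Nat as ℕ using (ℕ)
open import Data.Nat.DivMod using (_%_)
open import Data.Fin as Fin using (Fin; toℕ; fromℕ<)
open import Data.Integer as ℤ using (ℤ; +_; -[1+_])
open import Data.Product using (_×_; _,_)
open import Data.List using (List; []; _∷_; map; foldr; length; filter; cartesianProduct)
open import Data.List using () renaming (allFin to allFinL)
open import Data.Sum using (_⊎_)
open import Relation.Binary.PropositionalEquality using (_≡_; _≢_)
open import Relation.Nullary.Decidable using (Dec; yes; no; ⌊_⌋; ¬?)
open import Data.Bool using (Bool; true; false; _∨_)

infixl 6 _⊕_
_⊕_ : {n : ℕ} → Fin (ℕ.suc n) → Fin (ℕ.suc n) → Fin (ℕ.suc n)
_⊕_ {n} a b = fromℕ< (Data.Nat.DivMod.m%n<n (toℕ a ℕ.+ toℕ b) (ℕ.suc n))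

G : Set
G = Fin 2 × Fin 3 × Fin 3

_+G_ : G → G → G
(a , b , c) +G (a' , b' , c') = (a ⊕ a') , (b ⊕ b') , (c ⊕ c')

0G : G
0G = (Fin.zero , Fin.zero , Fin.zero)

elemsG : List G
elemsG = cartesianProduct (allFinL 2) (cartesianProduct (allFinL 3) (allFinL 3))

-- A signed difference set D = Σ s_g g in the abelian group G, given by its
-- coefficient function s : G → ℤ:
--   * s_g ∈ {-1, 0, 1} for all g,
--   * k = |P| + |N| = #{g : s_g ≠ 0},
--   * Σ_g s_g s_{g+h} = λ for every nonzero h.
IsSignedDiffSet : (s : G → ℤ) (v k lam : ℕ) → Set
IsSignedDiffSet s v k lam =
    (∀ g → s g ≡ + 1 ⊎ s g ≡ + 0 ⊎ s g ≡ -[1+ 0 ])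
  × length elemsG ≡ v
  × length (filter (λ g → ¬? (s g ℤ.≟ + 0)) elemsG) ≡ k
  × (∀ h → h ≢ 0G → foldr ℤ._+_ (+ 0) (map (λ g → s g ℤ.* s (g +G h)) elemsG) ≡ + lam)

import Data.Product.Properties as PP

_≟G_ : (x y : G) → Dec (x ≡ y)
_≟G_ = PP.≡-dec Fin._≟_ (PP.≡-dec Fin._≟_ Fin._≟_)

_∈?_ : G → List G → Bool
g ∈? [] = false
g ∈? (x ∷ xs) = ⌊ g ≟G x ⌋ ∨ (g ∈? xs)

Pset : List G
Pset =
  (0F , 0F , 1F) ∷ (0F , 1F , 1F) ∷ (0F , 2F , 1F) ∷
  (0F , 0F , 2F) ∷ (0F , 1F , 2F) ∷ (0F , 2F , 2F) ∷
  (1F , 2F , 0F) ∷ (1F , 2F , 1F) ∷ (1F , 2F , 2F) ∷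
  (1F , 0F , 1F) ∷ (1F , 1F , 0F) ∷ []
  where open import Data.Fin.Patterns using (0F; 1F; 2F)

Nset : List G
Nset = (1F , 0F , 0F) ∷ (1F , 1F , 1F) ∷ []
  where open import Data.Fin.Patterns using (0F; 1F; 2F)

-- coefficient function of D = P - N (P and N are disjoint)
Dcoef : G → ℤ
Dcoef g with g ∈? Pset | g ∈? Nset
... | true  | _     = + 1
... | false | true  = -[1+ 0 ]
... | false | false = + 0

{-# OPTIONS --safe #-}
module Submission where

open import Defs
open import Data.Bool using (true; false)
open import Data.Empty using (⊥-elim)
open import Data.Fin.Patterns using (0F; 1F; 2F)
open import Data.Integer as ℤ using (ℤ; +_; -[1+_])
open import Data.List using (foldr; map)
open import Data.Product using (_,_)
open import Data.Sum using (_⊎_; inj₁; inj₂)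
open import Relation.Binary.PropositionalEquality using (_≡_; _≢_; refl)

IsSign : ℤ → Set
IsSign x = x ≡ + 1 ⊎ x ≡ + 0 ⊎ x ≡ -[1+ 0 ]

autocorrelation : (G → ℤ) → G → ℤ
autocorrelation s h = foldr ℤ._+_ (+ 0) (map (λ g → s g ℤ.* s (g +G h)) elemsG)

Dcoef-isSign : ∀ g → IsSign (Dcoef g)
Dcoef-isSign g with g ∈? Pset | g ∈? Nset
... | true  | _     = inj₁ refl
... | false | true  = inj₂ (inj₂ refl)
... | false | false = inj₂ (inj₁ refl)

autocorrelation-Dcoef : ∀ h → h ≢ 0G → autocorrelation Dcoef h ≡ + 4
autocorrelation-Dcoef (0F , 0F , 0F) h≢0 = ⊥-elim (h≢0 refl)
autocorrelation-Dcoef (0F , 0F , 1F) _ = refl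
autocorrelation-Dcoef (0F , 0F , 2F) _ = refl
autocorrelation-Dcoef (0F , 1F , 0F) _ = refl
autocorrelation-Dcoef (0F , 1F , 1F) _ = refl
autocorrelation-Dcoef (0F , 1F , 2F) _ = refl
autocorrelation-Dcoef (0F , 2F , 0F) _ = refl
autocorrelation-Dcoef (0F , 2F , 1F) _ = refl
autocorrelation-Dcoef (0F , 2F , 2F) _ = refl
autocorrelation-Dcoef (1F , 0F , 0F) _ = refl
autocorrelation-Dcoef (1F , 0F , 1F) _ = refl
autocorrelation-Dcoef (1F , 0F , 2F) _ = refl
autocorrelation-Dcoef (1F , 1F , 0F) _ = refl
autocorrelation-Dcoef (1F , 1F , 1F) _ = refl
autocorrelation-Dcoef (1F , 1F , 2F) _ = refl
autocorrelation-Dcoef (1F , 2F , 0F) _ = refl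
autocorrelation-Dcoef (1F , 2F , 1F) _ = refl
autocorrelation-Dcoef (1F , 2F , 2F) _ = refl

mainTheorem8 : IsSignedDiffSet Dcoef 18 13 4
mainTheorem8 = Dcoef-isSign , refl , refl , autocorrelation-Dcoef
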